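{- None of the following matrices is equivalent to its transpose: $M_n$ ($n\ge2$), $B_n$ ($n\ge3$), $\widetilde B_n$ ($n\ge3$), $\widetilde C_n$ ($n\ge2$), $\widetilde F_4$, $\widetilde G_2$, $L_n$ (even $n\ge6$), $L_n^+$ (odd $n\ge3$). Furthermore, for each even $n\ge4$, $L_n$ and $L_n'$ are not equivalent.
   Context: Two square matrices $A,B$ are equivalent if $P^{\mathsf T}AP=\pm B$ for some signed permutation matrix $P$. Only nonzero entries are listed; "path $v_1,\dots,v_m$" means $a_{v_tv_{t+1}}=a_{v_{t+1}v_t}=1$ unless stated otherwise. $M_n$: path $v_1,\dots,v_n$ with $a_{v_nv_n}=1$, except $a_{v_1v_2}=1,a_{v_2v_1}=2$. $B_n$: path $v_1,\dots,v_n$ except $a_{v_1v_2}=1,a_{v_2v_1}=2$. $\widetilde B_n$: path $v_1,\dots,v_{n-1}$ plus vertices $z,z'$ each joined to $v_1$ with weight 1 both ways, except $a_{v_{n-2}v_{n-1}}=2,a_{v_{n-1}v_{n-2}}=1$. $\widetilde C_n$: path $v_0,\dots,v_n$ except $a_{v_0v_1}=1,a_{v_1v_0}=2,a_{v_{n-1}v_n}=2,a_{v_nv_{n-1}}=1$. $\widetilde F_4$: path $v_1,\dots,v_5$ except $a_{v_3v_4}=1,a_{v_4v_3}=2$. $\widetilde G_2$: path $v_1,v_2,v_3$ except $a_{v_2v_3}=1,a_{v_3v_2}=3$. Ladder ($r\ge1$): vertices $x_1..x_r,y_1..y_r$ with, for $1\le t\le r-1$: $a_{x_tx_{t+1}}=a_{x_{t+1}x_t}=1$,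 $a_{y_ty_{t+1}}=a_{y_{t+1}y_t}=-1$, $a_{x_ty_{t+1}}=a_{y_{t+1}x_t}=1$, $a_{y_tx_{t+1}}=a_{x_{t+1}y_t}=-1$. $L_n$ ($n=2r+2$): ladder plus $w_0,w_1$ with $a_{w_0x_1}=a_{w_0y_1}=2$, $a_{x_1w_0}=a_{y_1w_0}=1$, $a_{w_1x_r}=2,a_{x_rw_1}=1,a_{w_1y_r}=-2,a_{y_rw_1}=-1$. $L_n'$: as $L_n$ but $a_{w_1x_r}=1,a_{x_rw_1}=2,a_{w_1y_r}=-1,a_{y_rw_1}=-2$. $L_n^+$ ($n=2r+1$): ladder plus $w_0$ with $a_{w_0x_1}=a_{w_0y_1}=1$, $a_{x_1w_0}=a_{y_1w_0}=2$, and $a_{x_rx_r}=a_{y_ry_r}=1$, $a_{x_ry_r}=a_{y_rx_r}=-1$. -}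

module Defs where

open import Data.Bool.Base using (Bool; true; false; if_then_else_; _∧_; _∨_)
open import Data.Nat.Base as ℕ using (ℕ; zero; suc; _≡ᵇ_; _<ᵇ_; _∸_)
open import Data.Integer.Base using (ℤ; +_; -_; _+_; _*_; 0ℤ; 1ℤ; -1ℤ)
open import Data.Fin.Base using (Fin; toℕ)
open import Data.Fin.Properties using (_≟_)
open import Data.Fin.Permutation using (Permutation′; _⟨$⟩ʳ_)
open import Data.Product.Base using (∃)
open import Data.Sum.Base using (_⊎_)
open import Relation.Nullary.Decidable using (does)
open import Relation.Binary.PropositionalEquality using (_≡_)

Matrix : ℕ → Set
Matrix n = Fin n → Fin n → ℤ

sumFin : ∀ {n} → (Fin n → ℤ) → ℤ
sumFin {zero}  f = 0ℤ
sumFin {suc n} f = f Fin.zero + sumFin (λ i → f (Fin.suc i))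

_·_ : ∀ {n} → Matrix n → Matrix n → Matrix n
(A · B) i j = sumFin (λ k → A i k * B k j)

infixl 7 _·_

_ᵀ : ∀ {n} → Matrix n → Matrix n
(A ᵀ) i j = A j i

negM : ∀ {n} → Matrix n → Matrix n
negM A i j = - A i j

_≐_ : ∀ {n} → Matrix n → Matrix n → Set
A ≐ B = ∀ i j → A i j ≡ B i j

record SignedPerm (n : ℕ) : Set where
  field
    σ     : Permutation′ n
    sign  : Fin n → ℤ
    signs : ∀ j → sign j ≡ 1ℤ ⊎ sign j ≡ -1ℤ

  matrix : Matrix n
  matrix i j = if does (i ≟ (σ ⟨$⟩ʳ j)) then sign j else 0ℤ

Equivalent : ∀ {n} → Matrix n → Matrix n → Set
Equivalent {n} A B =
  ∃ λ (P : SignedPerm n) →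
    let Q = SignedPerm.matrix P in
    ((Q ᵀ · A · Q) ≐ B) ⊎ ((Q ᵀ · A · Q) ≐ negM B)

fromℕ : ∀ {n} → (ℕ → ℕ → ℤ) → Matrix n
fromℕ f i j = f (toℕ i) (toℕ j)

adj : ℕ → ℕ → Bool
adj i j = (j ≡ᵇ suc i) ∨ (i ≡ᵇ suc j)

-- M_n : v_t ↦ t-1.  Path, a_{v_n v_n} = 1, a_{v_1v_2} = 1, a_{v_2v_1} = 2.
M-entry : ℕ → ℕ → ℕ → ℤ
M-entry n i j =
  if (i ≡ᵇ 1) ∧ (j ≡ᵇ 0) then + 2
  else if adj i j then + 1
  else if (i ≡ᵇ n ∸ 1) ∧ (j ≡ᵇ n ∸ 1) then + 1
  else 0ℤ

M : (n : ℕ) → Matrix n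
M n = fromℕ (M-entry n)

-- B_n : v_t ↦ t-1.  Path, a_{v_1v_2} = 1, a_{v_2v_1} = 2.
B-entry : ℕ → ℕ → ℤ
B-entry i j =
  if (i ≡ᵇ 1) ∧ (j ≡ᵇ 0) then + 2
  else if adj i j then + 1
  else 0ℤ

B : (n : ℕ) → Matrix n
B n = fromℕ B-entry

-- B̃_n (n+1 vertices): v_t ↦ t-1 (t = 1..n-1), z ↦ n-1, z' ↦ n.
-- Path v_1..v_{n-1}, z and z' joined to v_1 (weight 1 both ways),
-- a_{v_{n-2}v_{n-1}} = 2, a_{v_{n-1}v_{n-2}} = 1.
Bt-entry : ℕ → ℕ → ℕ → ℤ
Bt-entry n i j =
  if (i ≡ᵇ n ∸ 3) ∧ (j ≡ᵇ n ∸ 2) then + 2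
  else if (i <ᵇ n ∸ 1) ∧ (j <ᵇ n ∸ 1) ∧ adj i j then + 1
  else if (i ≡ᵇ 0) ∧ ((j ≡ᵇ n ∸ 1) ∨ (j ≡ᵇ n)) then + 1
  else if (j ≡ᵇ 0) ∧ ((i ≡ᵇ n ∸ 1) ∨ (i ≡ᵇ n)) then + 1
  else 0ℤ

Bt : (n : ℕ) → Matrix (suc n)
Bt n = fromℕ (Bt-entry n)

-- C̃_n (n+1 vertices): v_t ↦ t (t = 0..n).  Path, a_{v_0v_1} = 1,
-- a_{v_1v_0} = 2, a_{v_{n-1}v_n} = 2, a_{v_nv_{n-1}} = 1.
Ct-entry : ℕ → ℕ → ℕ → ℤ
Ct-entry n i j =
  if (i ≡ᵇ 0) ∧ (j ≡ᵇ 1) then + 1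
  else if (i ≡ᵇ 1) ∧ (j ≡ᵇ 0) then + 2
  else if (i ≡ᵇ n ∸ 1) ∧ (j ≡ᵇ n) then + 2
  else if (i ≡ᵇ n) ∧ (j ≡ᵇ n ∸ 1) then + 1
  else if adj i j then + 1
  else 0ℤ

Ct : (n : ℕ) → Matrix (suc n)
Ct n = fromℕ (Ct-entry n)

-- F̃_4 : v_t ↦ t-1.  Path v_1..v_5, a_{v_3v_4} = 1, a_{v_4v_3} = 2.
F4t : Matrix 5
F4t = fromℕ λ i j →
  if (i ≡ᵇ 3) ∧ (j ≡ᵇ 2) then + 2
  else if adj i j then + 1
  else 0ℤ

-- G̃_2 : v_t ↦ t-1.  Path v_1,v_2,v_3, a_{v_2v_3} = 1, a_{v_3v_2} = 3.
G2t : Matrix 3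
G2t = fromℕ λ i j →
  if (i ≡ᵇ 2) ∧ (j ≡ᵇ 1) then + 3
  else if adj i j then + 1
  else 0ℤ

-- Ladder-type matrices.  Vertices: x t  stands for x_{t+1},
-- y t for y_{t+1} (t = 0..r-1), plus w₀, w₁.

data LV : Set where
  x y : ℕ → LV
  w₀ w₁ : LV

decode : ℕ → ℕ → LV
decode r i =
  if i <ᵇ r then x i
  else if i <ᵇ r ℕ.+ r then y (i ∸ r)
  else if i ≡ᵇ r ℕ.+ r then w₀
  else w₁

b2 : Bool → ℤ → ℤ
b2 b v = if b then v else 0ℤ

ladder : LV → LV → ℤ
ladder (x i) (x j) = b2 (adj i j) 1ℤ
ladder (y i) (y j) = b2 (adj i j) -1ℤ
ladder (x i) (y j) = b2 (j ≡ᵇ suc i) 1ℤ + b2 (i ≡ᵇ suc j) -1ℤ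
ladder (y i) (x j) = b2 (i ≡ᵇ suc j) 1ℤ + b2 (j ≡ᵇ suc i) -1ℤ
ladder _ _ = 0ℤ

w₀L : LV → LV → ℤ
w₀L w₀ (x i) = b2 (i ≡ᵇ 0) (+ 2)
w₀L w₀ (y i) = b2 (i ≡ᵇ 0) (+ 2)
w₀L (x i) w₀ = b2 (i ≡ᵇ 0) 1ℤ
w₀L (y i) w₀ = b2 (i ≡ᵇ 0) 1ℤ
w₀L _ _ = 0ℤ

w₁L : ℕ → LV → LV → ℤ
w₁L r w₁ (x i) = b2 (i ≡ᵇ r ∸ 1) (+ 2)
w₁L r (x i) w₁ = b2 (i ≡ᵇ r ∸ 1) 1ℤ
w₁L r w₁ (y i) = b2 (i ≡ᵇ r ∸ 1) (- + 2)
w₁L r (y i) w₁ = b2 (i ≡ᵇ r ∸ 1) -1ℤ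
w₁L r _ _ = 0ℤ

w₁L' : ℕ → LV → LV → ℤ
w₁L' r w₁ (x i) = b2 (i ≡ᵇ r ∸ 1) 1ℤ
w₁L' r (x i) w₁ = b2 (i ≡ᵇ r ∸ 1) (+ 2)
w₁L' r w₁ (y i) = b2 (i ≡ᵇ r ∸ 1) -1ℤ
w₁L' r (y i) w₁ = b2 (i ≡ᵇ r ∸ 1) (- + 2)
w₁L' r _ _ = 0ℤ

w₀L⁺ : LV → LV → ℤ
w₀L⁺ w₀ (x i) = b2 (i ≡ᵇ 0) 1ℤ
w₀L⁺ w₀ (y i) = b2 (i ≡ᵇ 0) 1ℤ
w₀L⁺ (x i) w₀ = b2 (i ≡ᵇ 0) (+ 2)
w₀L⁺ (y i) w₀ = b2 (i ≡ᵇ 0) (+ 2)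
w₀L⁺ _ _ = 0ℤ

endL⁺ : ℕ → LV → LV → ℤ
endL⁺ r (x i) (x j) = b2 ((i ≡ᵇ r ∸ 1) ∧ (j ≡ᵇ r ∸ 1)) 1ℤ
endL⁺ r (y i) (y j) = b2 ((i ≡ᵇ r ∸ 1) ∧ (j ≡ᵇ r ∸ 1)) 1ℤ
endL⁺ r (x i) (y j) = b2 ((i ≡ᵇ r ∸ 1) ∧ (j ≡ᵇ r ∸ 1)) -1ℤ
endL⁺ r (y i) (x j) = b2 ((i ≡ᵇ r ∸ 1) ∧ (j ≡ᵇ r ∸ 1)) -1ℤ
endL⁺ r _ _ = 0ℤ

-- L_n with n = 2r+2
L : (r : ℕ) → Matrix (suc (suc (r ℕ.+ r)))
L r = fromℕ λ i j → let u = decode r i ; v = decode r j in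
  ladder u v + w₀L u v + w₁L r u v

-- L_n' with n = 2r+2
L' : (r : ℕ) → Matrix (suc (suc (r ℕ.+ r)))
L' r = fromℕ λ i j → let u = decode r i ; v = decode r j in
  ladder u v + w₀L u v + w₁L' r u v

-- L_n^+ with n = 2r+1
L⁺ : (r : ℕ) → Matrix (suc (r ℕ.+ r))
L⁺ r = fromℕ λ i j → let u = decode r i ; v = decode r j in
  ladder u v + w₀L⁺ u v + endL⁺ r u v

-- An equivalence Pᵀ A P = ± B with P a signed permutation only matters here through its
-- shadow: a relabelling τ of the indices with |A(τ k, τ l)| = |B(k, l)|.  Such a τ must
-- carry the entries of exceptional absolute value (the multiple bonds, and the weights 2
-- attaching w₀ and w₁ in the ladders) onto each other, and transposition reverses their
-- orientation.  For M_n, B_n, B̃_n and G̃₂ the reversed bond would join the leaf at its end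
-- to a vertex with a second neighbour; for C̃_n and F̃₄ a short walk from the bond ends at a
-- leaf on one side only.  In L_n, L_n' and L_n⁺ the rows (columns for L_n⁺) containing a 2
-- are those of w₀, w₁ (of w₀ alone), while the other side of the comparison has three (two)
-- such rows or columns, contradicting injectivity of τ.
module Submission where

open import Defs
open import Data.Bool.Base using (true; false; _∧_; _∨_; if_then_else_)
open import Data.Bool.Properties using (T-≡; T-∧; ∧-zeroʳ)
open import Data.Empty using (⊥; ⊥-elim)
open import Data.Fin.Base using (Fin; toℕ; fromℕ<)
open import Data.Fin.Permutation using (_⟨$⟩ʳ_; _⟨$⟩ˡ_; inverseˡ)
open import Data.Fin.Properties using (_≟_; suc-injective; toℕ-fromℕ<; toℕ-injective; toℕ<n)
open import Data.Integer.Base using (ℤ; +_; _+_; _*_; 0ℤ; ∣_∣)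
open import Data.Integer.Properties as ℤ using (abs-*; ∣-i∣≡∣i∣)
open import Data.Nat.Base as ℕ using (ℕ; zero; suc; _≤_; _<_; _∸_; _≡ᵇ_; _<ᵇ_; z≤n; s≤s; z<s; s<s)
open import Data.Nat.Properties as ℕ using (≡ᵇ⇒≡; ≡⇒≡ᵇ; <ᵇ⇒<; <⇒<ᵇ)
open import Data.Product.Base using (_×_; _,_; proj₁; proj₂; swap)
open import Data.Sum.Base using (_⊎_; inj₁; inj₂; [_,_]′)
open import Function.Base using (flip; _∘_; case_of_)
open import Function.Bundles using (Equivalence)
open import Relation.Nullary using (¬_; yes; no)
open import Relation.Binary.PropositionalEquality hiding ([_])

≡ᵇ-true⇒≡ : ∀ {m n} → (m ≡ᵇ n) ≡ true → m ≡ n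
≡ᵇ-true⇒≡ {m} {n} e = ≡ᵇ⇒≡ m n (Equivalence.from T-≡ e)

≢⇒≡ᵇ-false : ∀ {m n} → m ≢ n → (m ≡ᵇ n) ≡ false
≢⇒≡ᵇ-false {m} {n} m≢n with m ≡ᵇ n in e
... | true  = ⊥-elim (m≢n (≡ᵇ-true⇒≡ e))
... | false = refl

≡ᵇ-refl : ∀ m → (m ≡ᵇ m) ≡ true
≡ᵇ-refl m = Equivalence.to T-≡ (≡⇒≡ᵇ m m refl)

<⇒<ᵇ-true : ∀ {m n} → m < n → (m <ᵇ n) ≡ true
<⇒<ᵇ-true = Equivalence.to T-≡ ∘ <⇒<ᵇ

<ᵇ-true⇒< : ∀ {m n} → (m <ᵇ n) ≡ true → m < n
<ᵇ-true⇒< {m} {n} e = <ᵇ⇒< m n (Equivalence.from T-≡ e)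

≥⇒<ᵇ-false : ∀ {m n} → n ≤ m → (m <ᵇ n) ≡ false
≥⇒<ᵇ-false {m} {n} n≤m with m <ᵇ n in e
... | true  = ⊥-elim (ℕ.<⇒≱ (<ᵇ-true⇒< e) n≤m)
... | false = refl

∧-true⇒≡×≡ : ∀ {i j m n} → ((i ≡ᵇ m) ∧ (j ≡ᵇ n)) ≡ true → i ≡ m × j ≡ n
∧-true⇒≡×≡ e with Equivalence.to T-∧ (Equivalence.from T-≡ e)
... | t , u = ≡ᵇ⇒≡ _ _ t , ≡ᵇ⇒≡ _ _ u

sumFin-≡0 : ∀ {n} (f : Fin n → ℤ) → (∀ k → f k ≡ 0ℤ) → sumFin f ≡ 0ℤ
sumFin-≡0 {zero}  f f≡0 = refl
sumFin-≡0 {suc n} f f≡0 =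
  cong₂ _+_ (f≡0 Fin.zero) (sumFin-≡0 (λ k → f (Fin.suc k)) (λ k → f≡0 (Fin.suc k)))

sumFin-concentrated : ∀ {n} (f : Fin n → ℤ) p → (∀ k → k ≢ p → f k ≡ 0ℤ) → sumFin f ≡ f p
sumFin-concentrated {suc n} f Fin.zero f≡0
  rewrite sumFin-≡0 (λ k → f (Fin.suc k)) (λ k → f≡0 (Fin.suc k) λ ())
  = ℤ.+-identityʳ (f Fin.zero)
sumFin-concentrated {suc n} f (Fin.suc p) f≡0
  rewrite f≡0 Fin.zero (λ ())
  = trans (ℤ.+-identityˡ _)
      (sumFin-concentrated (λ k → f (Fin.suc k)) p (λ k k≢p → f≡0 (Fin.suc k) (k≢p ∘ suc-injective)))

module _ {n} (P : SignedPerm n) where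
  open SignedPerm P

  π : Fin n → Fin n
  π j = σ ⟨$⟩ʳ j

  π-injective : ∀ {i j} → π i ≡ π j → i ≡ j
  π-injective {i} {j} e = trans (sym (inverseˡ σ)) (trans (cong (σ ⟨$⟩ˡ_) e) (inverseˡ σ))

  matrix-on-graph : ∀ j → matrix (π j) j ≡ sign j
  matrix-on-graph j with π j ≟ π j
  ... | yes _ = refl
  ... | no ≢ = ⊥-elim (≢ refl)

  matrix-off-graph : ∀ i j → i ≢ π j → matrix i j ≡ 0ℤ
  matrix-off-graph i j i≢πj with i ≟ π j
  ... | yes i≡πj = ⊥-elim (i≢πj i≡πj)
  ... | no _ = refl

  conjugate-entry : (A : Matrix n) → ∀ i j → (matrix ᵀ · A · matrix) i j ≡ sign i * A (π i) (π j) * sign j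
  conjugate-entry A i j = begin
    (matrix ᵀ · A · matrix) i j
      ≡⟨ sumFin-concentrated _ (π j) (λ k k≢πj → trans (cong ((matrix ᵀ · A) i k *_) (matrix-off-graph k j k≢πj))
                                                        (ℤ.*-zeroʳ ((matrix ᵀ · A) i k))) ⟩
    (matrix ᵀ · A) i (π j) * matrix (π j) j
      ≡⟨ cong₂ _*_ (sumFin-concentrated _ (π i) (λ k k≢πi → cong (_* A k (π j)) (matrix-off-graph k i k≢πi)))
                   (matrix-on-graph j) ⟩
    matrix (π i) i * A (π i) (π j) * sign j
      ≡⟨ cong (λ s → s * A (π i) (π j) * sign j) (matrix-on-graph i) ⟩
    sign i * A (π i) (π j) * sign j ∎
    where open ≡-Reasoning

  ∣sign∣≡1 : ∀ j → ∣ sign j ∣ ≡ 1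
  ∣sign∣≡1 j with signs j
  ... | inj₁ s≡1  rewrite s≡1  = refl
  ... | inj₂ s≡-1 rewrite s≡-1 = refl

  ∣conjugate-entry∣ : (A : Matrix n) → ∀ i j → ∣ (matrix ᵀ · A · matrix) i j ∣ ≡ ∣ A (π i) (π j) ∣
  ∣conjugate-entry∣ A i j = begin
    ∣ (matrix ᵀ · A · matrix) i j ∣            ≡⟨ cong ∣_∣ (conjugate-entry A i j) ⟩
    ∣ sign i * A (π i) (π j) * sign j ∣        ≡⟨ abs-* (sign i * A (π i) (π j)) (sign j) ⟩
    ∣ sign i * A (π i) (π j) ∣ ℕ.* ∣ sign j ∣  ≡⟨ cong₂ ℕ._*_ (abs-* (sign i) (A (π i) (π j))) (∣sign∣≡1 j) ⟩
    ∣ sign i ∣ ℕ.* ∣ A (π i) (π j) ∣ ℕ.* 1     ≡⟨ cong (λ s → s ℕ.* ∣ A (π i) (π j) ∣ ℕ.* 1) (∣sign∣≡1 i) ⟩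
    1 ℕ.* ∣ A (π i) (π j) ∣ ℕ.* 1              ≡⟨ ℕ.*-identityʳ _ ⟩
    1 ℕ.* ∣ A (π i) (π j) ∣                    ≡⟨ ℕ.*-identityˡ _ ⟩
    ∣ A (π i) (π j) ∣ ∎
    where open ≡-Reasoning

record AbsConjugate (N : ℕ) (f g : ℕ → ℕ → ℤ) : Set where
  field
    τ           : ∀ k → .(k < N) → ℕ
    τ-<         : ∀ k .p → τ k p < N
    τ-injective : ∀ k l .p .q → τ k p ≡ τ l q → k ≡ l
    ∣f∘τ∣≡∣g∣    : ∀ k l .p .q → ∣ f (τ k p) (τ l q) ∣ ≡ ∣ g k l ∣

equivalent⇒absConjugate : ∀ {N} (f g : ℕ → ℕ → ℤ) → Equivalent {N} (fromℕ f) (fromℕ g) → AbsConjugate N f g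
equivalent⇒absConjugate {N} f g (P , PᵀfP≐±g) = record
  { τ           = λ k p → toℕ (π P (fromℕ< p))
  ; τ-<         = λ k p → toℕ<n _
  ; τ-injective = λ k l p q e →
      trans (sym (toℕ-fromℕ< p)) (trans (cong toℕ (π-injective P (toℕ-injective e))) (toℕ-fromℕ< q))
  ; ∣f∘τ∣≡∣g∣    = λ k l p q → begin
      ∣ fromℕ f (π P (fromℕ< p)) (π P (fromℕ< q)) ∣  ≡⟨ ∣conjugate-entry∣ P (fromℕ f) (fromℕ< p) (fromℕ< q) ⟨
      ∣ Qᵀ·f·Q (fromℕ< p) (fromℕ< q) ∣              ≡⟨ ±-∣≡∣ (fromℕ< p) (fromℕ< q) ⟩
      ∣ g (toℕ (fromℕ< p)) (toℕ (fromℕ< q)) ∣        ≡⟨ cong₂ (λ a b → ∣ g a b ∣) (toℕ-fromℕ< p) (toℕ-fromℕ< q) ⟩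
      ∣ g k l ∣                                      ∎
  }
  where
  open ≡-Reasoning
  Q Qᵀ·f·Q : Matrix N
  Q = SignedPerm.matrix P
  Qᵀ·f·Q = Q ᵀ · fromℕ f · Q
  ±-∣≡∣ : ∀ i j → ∣ Qᵀ·f·Q i j ∣ ≡ ∣ fromℕ g i j ∣
  ±-∣≡∣ i j = [ (λ ≐g → cong ∣_∣ (≐g i j))
              , (λ ≐-g → trans (cong ∣_∣ (≐-g i j)) (∣-i∣≡∣i∣ (fromℕ g i j)))
              ]′ PᵀfP≐±g

self-transpose⇒AbsConjugate-flip : ∀ {N} f → Equivalent {N} (fromℕ f) (fromℕ f ᵀ) → AbsConjugate N f (flip f)
self-transpose⇒AbsConjugate-flip f = equivalent⇒absConjugate f (flip f)

RowSupportedAt : ℕ → (ℕ → ℕ → ℤ) → ℕ → ℕ → Set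
RowSupportedAt N f a s = ∀ j → j < N → ∣ f a j ∣ ≢ 0 → j ≡ s

module _ {N : ℕ} {f g : ℕ → ℕ → ℤ} (S : AbsConjugate N f g) where
  open AbsConjugate S

  τ-preserves-support : ∀ {a} k l .p .q → τ k p ≡ a → ∣ g k l ∣ ≢ 0 → ∣ f a (τ l q) ∣ ≢ 0
  τ-preserves-support k l p q refl ∣g∣≢0 ∣f∣≡0 = ∣g∣≢0 (trans (sym (∣f∘τ∣≡∣g∣ k l p q)) ∣f∣≡0)

  unique-neighbour-reflected : ∀ {a s} k k′ l .p .p′ .q → τ k p ≡ a → τ k′ p′ ≡ s →
                               RowSupportedAt N f a s → ∣ g k l ∣ ≢ 0 → l ≡ k′
  unique-neighbour-reflected k k′ l p p′ q τk≡a τk′≡s supp ∣g∣≢0 =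
    τ-injective l k′ q p′ (trans (supp (τ l q) (τ-< l q) (τ-preserves-support k l p q τk≡a ∣g∣≢0)) (sym τk′≡s))

AbsConjugate-flip : ∀ {N f g} → AbsConjugate N f g → AbsConjugate N (flip f) (flip g)
AbsConjugate-flip S = record
  { τ = τ ; τ-< = τ-< ; τ-injective = τ-injective ; ∣f∘τ∣≡∣g∣ = λ k l p q → ∣f∘τ∣≡∣g∣ l k q p }
  where open AbsConjugate S

-- τ swaps p and q, so a neighbour l of q goes to a neighbour of the leaf p = τ q, i.e. to q = τ p.
leaf-bond⇒¬AbsConjugate-flip :
  ∀ {N f c} p q l → .(p < N) → .(q < N) → .(l < N) →
  (∀ i j → ∣ f i j ∣ ≡ c → i ≡ q × j ≡ p) → ∣ f q p ∣ ≡ c →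
  RowSupportedAt N f p q → ∣ f l q ∣ ≢ 0 → l ≢ p → ¬ AbsConjugate N f (flip f)
leaf-bond⇒¬AbsConjugate-flip p q l p<N q<N l<N unique ∣fqp∣≡c leaf ∣flq∣≢0 l≢p S =
  l≢p (unique-neighbour-reflected S q p l q<N p<N l<N τq≡p τp≡q leaf ∣flq∣≢0)
  where
  open AbsConjugate S
  τp≡q×τq≡p : τ p p<N ≡ q × τ q q<N ≡ p
  τp≡q×τq≡p = unique (τ p p<N) (τ q q<N) (trans (∣f∘τ∣≡∣g∣ p q p<N q<N) ∣fqp∣≡c)
  τp≡q : τ p p<N ≡ q
  τp≡q = proj₁ τp≡q×τq≡p
  τq≡p : τ q q<N ≡ p
  τq≡p = proj₂ τp≡q×τq≡p

M-entry-∣2∣ : ∀ n i j → ∣ M-entry n i j ∣ ≡ 2 → i ≡ 1 × j ≡ 0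
M-entry-∣2∣ n i j h with (i ≡ᵇ 1) ∧ (j ≡ᵇ 0) in e | adj i j | (i ≡ᵇ n ∸ 1) ∧ (j ≡ᵇ n ∸ 1) | h
... | true  | _     | _     | _  = ∧-true⇒≡×≡ e
... | false | true  | _     | ()
... | false | false | true  | ()
... | false | false | false | ()

M-row₀ : ∀ m → RowSupportedAt (2 ℕ.+ m) (M-entry (2 ℕ.+ m)) 0 1
M-row₀ m zero          _ ∣f∣≢0 = ⊥-elim (∣f∣≢0 refl)
M-row₀ m (suc zero)    _ _     = refl
M-row₀ m (suc (suc j)) _ ∣f∣≢0 = ⊥-elim (∣f∣≢0 refl)

M-not-self-transpose : ∀ n → 2 ≤ n → ¬ Equivalent (M n) (M n ᵀ)
M-not-self-transpose (suc zero) (s≤s ())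
-- In M₂ the second neighbour of v₂ is v₂ itself, through the loop a_{v₂v₂}.
M-not-self-transpose (suc (suc zero)) _ =
  leaf-bond⇒¬AbsConjugate-flip 0 1 1 z<s (s<s z<s) (s<s z<s) (M-entry-∣2∣ 2) refl (M-row₀ 0) (λ ()) (λ ())
  ∘ self-transpose⇒AbsConjugate-flip (M-entry 2)
M-not-self-transpose (suc (suc (suc m))) _ =
  leaf-bond⇒¬AbsConjugate-flip 0 1 2 z<s (s<s z<s) (s<s (s<s z<s)) (M-entry-∣2∣ (3 ℕ.+ m)) refl (M-row₀ (suc m))
    (λ ()) (λ ())
  ∘ self-transpose⇒AbsConjugate-flip (M-entry (3 ℕ.+ m))

B-entry-∣2∣ : ∀ i j → ∣ B-entry i j ∣ ≡ 2 → i ≡ 1 × j ≡ 0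
B-entry-∣2∣ i j h with (i ≡ᵇ 1) ∧ (j ≡ᵇ 0) in e | adj i j | h
... | true  | _     | _  = ∧-true⇒≡×≡ e
... | false | true  | ()
... | false | false | ()

B-row₀ : ∀ N → RowSupportedAt N B-entry 0 1
B-row₀ N zero          _ ∣f∣≢0 = ⊥-elim (∣f∣≢0 refl)
B-row₀ N (suc zero)    _ _     = refl
B-row₀ N (suc (suc j)) _ ∣f∣≢0 = ⊥-elim (∣f∣≢0 refl)

B-not-self-transpose : ∀ n → 3 ≤ n → ¬ Equivalent (B n) (B n ᵀ)
B-not-self-transpose (suc zero)       (s≤s ())
B-not-self-transpose (suc (suc zero)) (s≤s (s≤s ()))
B-not-self-transpose (suc (suc (suc m))) _ =
  leaf-bond⇒¬AbsConjugate-flip 0 1 2 z<s (s<s z<s) (s<s (s<s z<s)) B-entry-∣2∣ refl (B-row₀ _) (λ ()) (λ ())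
  ∘ self-transpose⇒AbsConjugate-flip B-entry

Bt-entry-∣2∣ : ∀ n i j → ∣ Bt-entry n i j ∣ ≡ 2 → i ≡ n ∸ 3 × j ≡ n ∸ 2
Bt-entry-∣2∣ n i j h
  with (i ≡ᵇ n ∸ 3) ∧ (j ≡ᵇ n ∸ 2) in e | (i <ᵇ n ∸ 1) ∧ (j <ᵇ n ∸ 1) ∧ adj i j
     | (i ≡ᵇ 0) ∧ ((j ≡ᵇ n ∸ 1) ∨ (j ≡ᵇ n)) | (j ≡ᵇ 0) ∧ ((i ≡ᵇ n ∸ 1) ∨ (i ≡ᵇ n)) | h
... | true  | _     | _     | _     | _  = ∧-true⇒≡×≡ e
... | false | true  | _     | _     | ()
... | false | false | true  | _     | ()
... | false | false | false | true  | ()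
... | false | false | false | false | ()

Bt-bond : ∀ m → ∣ Bt-entry (3 ℕ.+ m) m (suc m) ∣ ≡ 2
Bt-bond m rewrite ≡ᵇ-refl m = refl

Bt-path-edge : ∀ m → ∣ Bt-entry (4 ℕ.+ m) m (suc m) ∣ ≢ 0
Bt-path-edge m
  rewrite ≢⇒≡ᵇ-false (ℕ.1+n≢n {m} ∘ sym) | <⇒<ᵇ-true (ℕ.m<n+m m {3} z<s) | <⇒<ᵇ-true (ℕ.m<n+m m {2} z<s)
        | ≡ᵇ-refl m = λ ()

Bt-row-end : ∀ m → RowSupportedAt (4 ℕ.+ m) (Bt-entry (3 ℕ.+ m)) (suc m) m
Bt-row-end m j _ ∣f∣≢0
  rewrite ≢⇒≡ᵇ-false (ℕ.1+n≢n {m}) | <⇒<ᵇ-true (ℕ.n<1+n m) | ≢⇒≡ᵇ-false (ℕ.1+n≢n {m} ∘ sym)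
        | ≢⇒≡ᵇ-false (ℕ.m≢1+n+m m {1}) | ∧-zeroʳ (j ≡ᵇ 0)
  with m ≡ᵇ j in m≡j | j <ᵇ 2 ℕ.+ m in j<2+m | j ≡ᵇ 2 ℕ.+ m in j≡2+m | ∣f∣≢0
... | true  | _     | _     | _     = sym (≡ᵇ-true⇒≡ {m} m≡j)
... | false | true  | true  | _     = ⊥-elim (ℕ.<-irrefl (≡ᵇ-true⇒≡ {j} j≡2+m) (<ᵇ-true⇒< {j} j<2+m))
... | false | true  | false | ∣f∣≢0 = ⊥-elim (∣f∣≢0 refl)
... | false | false | _     | ∣f∣≢0 = ⊥-elim (∣f∣≢0 refl)

Bt-not-self-transpose : ∀ n → 3 ≤ n → ¬ Equivalent (Bt n) (Bt n ᵀ)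
Bt-not-self-transpose (suc zero)       (s≤s ())
Bt-not-self-transpose (suc (suc zero)) (s≤s (s≤s ()))
Bt-not-self-transpose (suc (suc (suc zero))) _ =
  leaf-bond⇒¬AbsConjugate-flip 1 0 2 (s<s z<s) z<s (s<s (s<s z<s)) (Bt-entry-∣2∣ 3) refl (Bt-row-end 0)
    (λ ()) (λ ())
  ∘ self-transpose⇒AbsConjugate-flip (Bt-entry 3)
Bt-not-self-transpose (suc (suc (suc (suc m)))) _ =
  leaf-bond⇒¬AbsConjugate-flip (2 ℕ.+ m) (suc m) m (ℕ.m<n+m (2 ℕ.+ m) {3} z<s) (ℕ.m<n+m (suc m) {4} z<s)
    (ℕ.m<n+m m {5} z<s) (Bt-entry-∣2∣ (4 ℕ.+ m)) (Bt-bond (suc m)) (Bt-row-end (suc m)) (Bt-path-edge m)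
    (ℕ.m≢1+n+m m {1})
  ∘ self-transpose⇒AbsConjugate-flip (Bt-entry (4 ℕ.+ m))

Ct-entry-∣2∣ : ∀ n i j → ∣ Ct-entry n i j ∣ ≡ 2 → (i ≡ 1 × j ≡ 0) ⊎ (i ≡ n ∸ 1 × j ≡ n)
Ct-entry-∣2∣ n i j h
  with (i ≡ᵇ 0) ∧ (j ≡ᵇ 1) | (i ≡ᵇ 1) ∧ (j ≡ᵇ 0) in e₁ | (i ≡ᵇ n ∸ 1) ∧ (j ≡ᵇ n) in e₂
     | (i ≡ᵇ n) ∧ (j ≡ᵇ n ∸ 1) | adj i j | h
... | true  | _     | _     | _     | _     | ()
... | false | true  | _     | _     | _     | _  = inj₁ (∧-true⇒≡×≡ e₁)
... | false | false | true  | _     | _     | _  = inj₂ (∧-true⇒≡×≡ e₂)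
... | false | false | false | true  | _     | ()
... | false | false | false | false | true  | ()
... | false | false | false | false | false | ()

Ct-row₀ : ∀ m N → RowSupportedAt N (Ct-entry (2 ℕ.+ m)) 0 1
Ct-row₀ m N zero          _ ∣f∣≢0 = ⊥-elim (∣f∣≢0 refl)
Ct-row₀ m N (suc zero)    _ _     = refl
Ct-row₀ m N (suc (suc j)) _ ∣f∣≢0 = ⊥-elim (∣f∣≢0 refl)

Ct-edge₁₂ : ∀ m → ∣ Ct-entry (2 ℕ.+ m) 2 1 ∣ ≢ 0
Ct-edge₁₂ zero          ()
Ct-edge₁₂ (suc zero)    ()
Ct-edge₁₂ (suc (suc m)) ()

Ct-bond-end : ∀ m → ∣ Ct-entry (2 ℕ.+ m) (suc m) (2 ℕ.+ m) ∣ ≡ 2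
Ct-bond-end m rewrite ∧-zeroʳ (m ≡ᵇ 0) | ≡ᵇ-refl m = refl

Ct-edge-end : ∀ m → ∣ Ct-entry (2 ℕ.+ m) m (suc m) ∣ ≢ 0
Ct-edge-end zero    ()
Ct-edge-end (suc m)
  rewrite ∧-zeroʳ (m ≡ᵇ 0) | ≢⇒≡ᵇ-false (ℕ.1+n≢n {m} ∘ sym) | ≢⇒≡ᵇ-false (ℕ.m≢1+n+m m {1}) | ≡ᵇ-refl m
  = λ ()

module _ (m : ℕ) (S : AbsConjugate (3 ℕ.+ m) (Ct-entry (2 ℕ.+ m)) (flip (Ct-entry (2 ℕ.+ m)))) where
  open AbsConjugate S
  private
    0<N : 0 < 3 ℕ.+ m
    0<N = z<s
    1<N : 1 < 3 ℕ.+ m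
    1<N = s<s z<s
    2<N : 2 < 3 ℕ.+ m
    2<N = s<s (s<s z<s)
    n-2<N : m < 3 ℕ.+ m
    n-2<N = ℕ.m<n+m m {3} z<s
    n-1<N : suc m < 3 ℕ.+ m
    n-1<N = ℕ.m<n+m (suc m) {2} z<s
    n<N : 2 ℕ.+ m < 3 ℕ.+ m
    n<N = ℕ.n<1+n (2 ℕ.+ m)

  Ct-not-self-conjugate : ⊥
  Ct-not-self-conjugate with Ct-entry-∣2∣ (2 ℕ.+ m) (τ 0 0<N) (τ 1 1<N) (∣f∘τ∣≡∣g∣ 0 1 0<N 1<N)
  ... | inj₁ (τ₀≡1 , τ₁≡0) =
    case unique-neighbour-reflected S 1 0 2 1<N 0<N 2<N τ₁≡0 τ₀≡1 (Ct-row₀ m _) (Ct-edge₁₂ m) of λ ()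
  ... | inj₂ (τ₀≡1+m , _)
    with Ct-entry-∣2∣ (2 ℕ.+ m) (τ (2 ℕ.+ m) n<N) (τ (suc m) n-1<N)
           (trans (∣f∘τ∣≡∣g∣ (2 ℕ.+ m) (suc m) n<N n-1<N) (Ct-bond-end m))
  ...   | inj₁ (τₙ≡1 , τₙ₋₁≡0) =
    ℕ.m≢1+n+m m {1}
      (unique-neighbour-reflected S (suc m) (2 ℕ.+ m) m n-1<N n<N n-2<N τₙ₋₁≡0 τₙ≡1 (Ct-row₀ m _)
                                  (Ct-edge-end m))
  ...   | inj₂ (τₙ≡1+m , _) = case τ-injective (2 ℕ.+ m) 0 n<N 0<N (trans τₙ≡1+m (sym τ₀≡1+m)) of λ ()

Ct-not-self-transpose : ∀ n → 2 ≤ n → ¬ Equivalent (Ct n) (Ct n ᵀ)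
Ct-not-self-transpose (suc zero) (s≤s ())
Ct-not-self-transpose (suc (suc m)) _ = Ct-not-self-conjugate m ∘ self-transpose⇒AbsConjugate-flip (Ct-entry (2 ℕ.+ m))

F4-entry : ℕ → ℕ → ℤ
F4-entry i j =
  if (i ≡ᵇ 3) ∧ (j ≡ᵇ 2) then + 2
  else if adj i j then + 1
  else 0ℤ

F4-entry-∣2∣ : ∀ i j → ∣ F4-entry i j ∣ ≡ 2 → i ≡ 3 × j ≡ 2
F4-entry-∣2∣ i j h with (i ≡ᵇ 3) ∧ (j ≡ᵇ 2) in e | adj i j | h
... | true  | _     | _  = ∧-true⇒≡×≡ e
... | false | true  | ()
... | false | false | ()

F4-row₃ : ∀ j → ∣ F4-entry 3 j ∣ ≢ 0 → j ≡ 2 ⊎ j ≡ 4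
F4-row₃ 2 _ = inj₁ refl
F4-row₃ 4 _ = inj₂ refl
F4-row₃ 0 ∣f∣≢0 = ⊥-elim (∣f∣≢0 refl)
F4-row₃ 1 ∣f∣≢0 = ⊥-elim (∣f∣≢0 refl)
F4-row₃ 3 ∣f∣≢0 = ⊥-elim (∣f∣≢0 refl)
F4-row₃ (suc (suc (suc (suc (suc j))))) ∣f∣≢0 = ⊥-elim (∣f∣≢0 refl)

F4-row₄ : RowSupportedAt 5 F4-entry 4 3
F4-row₄ 3 _ _ = refl
F4-row₄ 0 _ ∣f∣≢0 = ⊥-elim (∣f∣≢0 refl)
F4-row₄ 1 _ ∣f∣≢0 = ⊥-elim (∣f∣≢0 refl)
F4-row₄ 2 _ ∣f∣≢0 = ⊥-elim (∣f∣≢0 refl)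
F4-row₄ 4 _ ∣f∣≢0 = ⊥-elim (∣f∣≢0 refl)
F4-row₄ (suc (suc (suc (suc (suc j))))) (s<s (s<s (s<s (s<s (s<s ()))))) _

module _ (S : AbsConjugate 5 F4-entry (flip F4-entry)) where
  open AbsConjugate S
  private
    0<5 : 0 < 5
    0<5 = z<s
    1<5 : 1 < 5
    1<5 = s<s z<s
    2<5 : 2 < 5
    2<5 = s<s (s<s z<s)
    3<5 : 3 < 5
    3<5 = s<s (s<s (s<s z<s))

  -- τ swaps v₃ and v₄, so v₂ goes to the leaf v₅, whose only neighbour v₄ = τ v₃ cannot be τ v₁.
  F4-not-self-conjugate : ⊥
  F4-not-self-conjugate with F4-entry-∣2∣ (τ 2 2<5) (τ 3 3<5) (∣f∘τ∣≡∣g∣ 2 3 2<5 3<5)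
  ... | τ₂≡3 , τ₃≡2 with F4-row₃ (τ 1 1<5) (τ-preserves-support S 2 1 2<5 1<5 τ₂≡3 (λ ()))
  ...   | inj₁ τ₁≡2 = case τ-injective 1 3 1<5 3<5 (trans τ₁≡2 (sym τ₃≡2)) of λ ()
  ...   | inj₂ τ₁≡4 = case unique-neighbour-reflected S 1 2 0 1<5 2<5 0<5 τ₁≡4 τ₂≡3 F4-row₄ (λ ()) of λ ()

F4-not-self-transpose : ¬ Equivalent F4t (F4t ᵀ)
F4-not-self-transpose = F4-not-self-conjugate ∘ self-transpose⇒AbsConjugate-flip F4-entry

G2-entry : ℕ → ℕ → ℤ
G2-entry i j =
  if (i ≡ᵇ 2) ∧ (j ≡ᵇ 1) then + 3
  else if adj i j then + 1
  else 0ℤ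

G2-entry-∣3∣ : ∀ i j → ∣ G2-entry i j ∣ ≡ 3 → i ≡ 2 × j ≡ 1
G2-entry-∣3∣ i j h with (i ≡ᵇ 2) ∧ (j ≡ᵇ 1) in e | adj i j | h
... | true  | _     | _  = ∧-true⇒≡×≡ e
... | false | true  | ()
... | false | false | ()

G2-column₂ : RowSupportedAt 3 (flip G2-entry) 2 1
G2-column₂ 1 _ _ = refl
G2-column₂ 0 _ ∣f∣≢0 = ⊥-elim (∣f∣≢0 refl)
G2-column₂ 2 _ ∣f∣≢0 = ⊥-elim (∣f∣≢0 refl)
G2-column₂ (suc (suc (suc j))) (s<s (s<s (s<s ()))) _

-- The leaf v₃ is the row, not the column, of the triple bond, so argue on the transpose.
G2-not-self-transpose : ¬ Equivalent G2t (G2t ᵀ)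
G2-not-self-transpose =
  leaf-bond⇒¬AbsConjugate-flip 2 1 0 (s<s (s<s z<s)) (s<s z<s) z<s (λ i j → swap ∘ G2-entry-∣3∣ j i) refl
    G2-column₂ (λ ()) (λ ())
  ∘ AbsConjugate-flip ∘ self-transpose⇒AbsConjugate-flip G2-entry

decode-x : ∀ {r i} → i < r → decode r i ≡ x i
decode-x i<r rewrite <⇒<ᵇ-true i<r = refl

decode-y : ∀ r {i} → i < r → decode r (r ℕ.+ i) ≡ y i
decode-y r {i} i<r
  rewrite ≥⇒<ᵇ-false (ℕ.m≤m+n r i) | <⇒<ᵇ-true (ℕ.+-monoʳ-< r i<r) | ℕ.m+n∸m≡n r i = refl

decode-w₀ : ∀ r → decode r (r ℕ.+ r) ≡ w₀
decode-w₀ r rewrite ≥⇒<ᵇ-false (ℕ.m≤m+n r r) | ≥⇒<ᵇ-false (ℕ.≤-refl {r ℕ.+ r}) | ≡ᵇ-refl (r ℕ.+ r) = refl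

decode-w₁ : ∀ r → decode r (suc (r ℕ.+ r)) ≡ w₁
decode-w₁ r
  rewrite ≥⇒<ᵇ-false (ℕ.m≤n⇒m≤1+n (ℕ.m≤m+n r r)) | ≥⇒<ᵇ-false (ℕ.n≤1+n (r ℕ.+ r))
        | ≢⇒≡ᵇ-false (ℕ.1+n≢n {r ℕ.+ r})
  = refl

decode-attachment⇒≥ : ∀ r a → decode r a ≡ w₀ ⊎ decode r a ≡ w₁ → r ℕ.+ r ≤ a
decode-attachment⇒≥ r a w with a <ᵇ r | a <ᵇ r ℕ.+ r in a<ᵇr+r | w
... | true  | _     | inj₁ ()
... | true  | _     | inj₂ ()
... | false | true  | inj₁ ()
... | false | true  | inj₂ ()
... | false | false | _ = ℕ.≮⇒≥ (λ a<r+r → case trans (sym a<ᵇr+r) (<⇒<ᵇ-true a<r+r) of λ ())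

decoded : ℕ → (LV → LV → ℤ) → ℕ → ℕ → ℤ
decoded r F i j = F (decode r i) (decode r j)

Lᵛ L′ᵛ L⁺ᵛ : ℕ → LV → LV → ℤ
Lᵛ  r u v = ladder u v + w₀L u v + w₁L r u v
L′ᵛ r u v = ladder u v + w₀L u v + w₁L' r u v
L⁺ᵛ r u v = ladder u v + w₀L⁺ u v + endL⁺ r u v

Lᵛ-∣2∣ : ∀ r u v → ∣ Lᵛ r u v ∣ ≡ 2 → u ≡ w₀ ⊎ u ≡ w₁
Lᵛ-∣2∣ r w₀ v h = inj₁ refl
Lᵛ-∣2∣ r w₁ v h = inj₂ refl
Lᵛ-∣2∣ r (x i) (x j) h with adj i j | h
... | true  | ()
... | false | ()
Lᵛ-∣2∣ r (y i) (y j) h with adj i j | h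
... | true  | ()
... | false | ()
Lᵛ-∣2∣ r (x i) (y j) h with j ≡ᵇ suc i | i ≡ᵇ suc j | h
... | true  | true  | ()
... | true  | false | ()
... | false | true  | ()
... | false | false | ()
Lᵛ-∣2∣ r (y i) (x j) h with i ≡ᵇ suc j | j ≡ᵇ suc i | h
... | true  | true  | ()
... | true  | false | ()
... | false | true  | ()
... | false | false | ()
Lᵛ-∣2∣ r (x i) w₀ h with i ≡ᵇ 0 | h
... | true  | ()
... | false | ()
Lᵛ-∣2∣ r (y i) w₀ h with i ≡ᵇ 0 | h
... | true  | ()
... | false | ()
Lᵛ-∣2∣ r (x i) w₁ h with i ≡ᵇ r ∸ 1 | h
... | true  | ()
... | false | ()
Lᵛ-∣2∣ r (y i) w₁ h with i ≡ᵇ r ∸ 1 | h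
... | true  | ()
... | false | ()

adj-irrefl : ∀ i → adj i i ≡ false
adj-irrefl i rewrite ≢⇒≡ᵇ-false (ℕ.1+n≢n {i} ∘ sym) = refl

end-diagonal : ∀ {i j k} → ((i ≡ᵇ k) ∧ (j ≡ᵇ k)) ≡ true → i ≡ j
end-diagonal e with ∧-true⇒≡×≡ e
... | i≡k , j≡k = trans i≡k (sym j≡k)

L⁺ᵛ-∣2∣ : ∀ r u v → ∣ L⁺ᵛ r u v ∣ ≡ 2 → v ≡ w₀
L⁺ᵛ-∣2∣ r u      w₀     h = refl
L⁺ᵛ-∣2∣ r w₀     w₁     ()
L⁺ᵛ-∣2∣ r w₁     w₁     ()
L⁺ᵛ-∣2∣ r (x i)  w₁     ()
L⁺ᵛ-∣2∣ r (y i)  w₁     ()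
L⁺ᵛ-∣2∣ r w₁     (x i)  ()
L⁺ᵛ-∣2∣ r w₁     (y i)  ()
L⁺ᵛ-∣2∣ r w₀ (x i) h with i ≡ᵇ 0 | h
... | true  | ()
... | false | ()
L⁺ᵛ-∣2∣ r w₀ (y i) h with i ≡ᵇ 0 | h
... | true  | ()
... | false | ()
L⁺ᵛ-∣2∣ r (x i) (x j) h with (i ≡ᵇ r ∸ 1) ∧ (j ≡ᵇ r ∸ 1) in end | adj i j in i~j | h
... | true  | true  | _  =
  case trans (sym (adj-irrefl i)) (subst (λ k → adj i k ≡ true) (sym (end-diagonal end)) i~j) of λ ()
... | true  | false | ()
... | false | true  | ()
... | false | false | ()
L⁺ᵛ-∣2∣ r (y i) (y j) h with (i ≡ᵇ r ∸ 1) ∧ (j ≡ᵇ r ∸ 1) | adj i j | h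
... | true  | true  | ()
... | true  | false | ()
... | false | true  | ()
... | false | false | ()
L⁺ᵛ-∣2∣ r (x i) (y j) h with j ≡ᵇ suc i | i ≡ᵇ suc j in i≡1+j | (i ≡ᵇ r ∸ 1) ∧ (j ≡ᵇ r ∸ 1) in end | h
... | false | true  | true  | _  = ⊥-elim (ℕ.1+n≢n {j} (trans (sym (≡ᵇ-true⇒≡ {i} i≡1+j)) (end-diagonal end)))
... | true  | true  | true  | ()
... | true  | true  | false | ()
... | true  | false | true  | ()
... | true  | false | false | ()
... | false | true  | false | ()
... | false | false | true  | ()
... | false | false | false | ()
L⁺ᵛ-∣2∣ r (y i) (x j) h with i ≡ᵇ suc j | j ≡ᵇ suc i in j≡1+i | (i ≡ᵇ r ∸ 1) ∧ (j ≡ᵇ r ∸ 1) in end | h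
... | false | true  | true  | _  = ⊥-elim (ℕ.1+n≢n {i} (trans (sym (≡ᵇ-true⇒≡ {j} j≡1+i)) (sym (end-diagonal end))))
... | true  | true  | true  | ()
... | true  | true  | false | ()
... | true  | false | true  | ()
... | true  | false | false | ()
... | false | true  | false | ()
... | false | false | true  | ()
... | false | false | false | ()

between⇒≡⊎≡suc : ∀ {m a} → m ≤ a → a < 2 ℕ.+ m → a ≡ m ⊎ a ≡ suc m
between⇒≡⊎≡suc {m} {a} m≤a a<2+m with ℕ.m≤n⇒m<n∨m≡n m≤a
... | inj₁ m<a = inj₂ (ℕ.≤-antisym (ℕ.≤-pred a<2+m) m<a)
... | inj₂ m≡a = inj₁ (sym m≡a)

three-in-two-collide : ∀ {m a b c : ℕ} → a ≡ m ⊎ a ≡ suc m → b ≡ m ⊎ b ≡ suc m → c ≡ m ⊎ c ≡ suc m →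
                       a ≡ b ⊎ a ≡ c ⊎ b ≡ c
three-in-two-collide (inj₁ a≡m)   (inj₁ b≡m)   _            = inj₁ (trans a≡m (sym b≡m))
three-in-two-collide (inj₂ a≡1+m) (inj₂ b≡1+m) _            = inj₁ (trans a≡1+m (sym b≡1+m))
three-in-two-collide (inj₁ a≡m)   (inj₂ _)     (inj₁ c≡m)   = inj₂ (inj₁ (trans a≡m (sym c≡m)))
three-in-two-collide (inj₂ a≡1+m) (inj₁ _)     (inj₂ c≡1+m) = inj₂ (inj₁ (trans a≡1+m (sym c≡1+m)))
three-in-two-collide (inj₁ _)     (inj₂ b≡1+m) (inj₂ c≡1+m) = inj₂ (inj₂ (trans b≡1+m (sym c≡1+m)))
three-in-two-collide (inj₂ _)     (inj₁ b≡m)   (inj₁ c≡m)   = inj₂ (inj₂ (trans b≡m (sym c≡m)))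

module _ {r} {g : ℕ → ℕ → ℤ} (S : AbsConjugate (2 ℕ.+ (r ℕ.+ r)) (decoded r (Lᵛ r)) g) where
  open AbsConjugate S

  τ-sends-∣2∣-row-to-attachment : ∀ k l .p .q → ∣ g k l ∣ ≡ 2 → τ k p ≡ r ℕ.+ r ⊎ τ k p ≡ suc (r ℕ.+ r)
  τ-sends-∣2∣-row-to-attachment k l p q ∣g∣≡2 =
    between⇒≡⊎≡suc (decode-attachment⇒≥ r _ (Lᵛ-∣2∣ r _ _ (trans (∣f∘τ∣≡∣g∣ k l p q) ∣g∣≡2))) (τ-< k p)

  rows-with-∣2∣-collide :
    ∀ a b c a′ b′ c′ .pa .pb .pc .pa′ .pb′ .pc′ → ∣ g a a′ ∣ ≡ 2 → ∣ g b b′ ∣ ≡ 2 → ∣ g c c′ ∣ ≡ 2 →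
    a ≡ b ⊎ a ≡ c ⊎ b ≡ c
  rows-with-∣2∣-collide a b c a′ b′ c′ pa pb pc pa′ pb′ pc′ ga gb gc
    with three-in-two-collide (τ-sends-∣2∣-row-to-attachment a a′ pa pa′ ga)
                              (τ-sends-∣2∣-row-to-attachment b b′ pb pb′ gb)
                              (τ-sends-∣2∣-row-to-attachment c c′ pc pc′ gc)
  ... | inj₁ τa≡τb        = inj₁ (τ-injective a b pa pb τa≡τb)
  ... | inj₂ (inj₁ τa≡τc) = inj₂ (inj₁ (τ-injective a c pa pc τa≡τc))
  ... | inj₂ (inj₂ τb≡τc) = inj₂ (inj₂ (τ-injective b c pb pc τb≡τc))

-- The index of y 0 is written r + 0 rather than r, so that decode-y applies to it.
L-not-self-transpose : ∀ r → 2 ≤ r → ¬ Equivalent (L r) (L r ᵀ)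
L-not-self-transpose (suc zero) (s≤s ())
L-not-self-transpose (suc (suc t)) _ L≅Lᵀ =
  distinct (rows-with-∣2∣-collide {r = r} S 0 (r ℕ.+ 0) (suc t) (r ℕ.+ r) (r ℕ.+ r) (suc (r ℕ.+ r))
              z<s y₀<N xₛ<N w₀<N w₀<N w₁<N w₀x₀ w₀y₀ w₁xₛ)
  where
  r : ℕ
  r = suc (suc t)
  S : AbsConjugate (2 ℕ.+ (r ℕ.+ r)) (decoded r (Lᵛ r)) (flip (decoded r (Lᵛ r)))
  S = self-transpose⇒AbsConjugate-flip (decoded r (Lᵛ r)) L≅Lᵀ
  y₀<N : r ℕ.+ 0 < 2 ℕ.+ (r ℕ.+ r)
  y₀<N = ℕ.m<n⇒m<1+n (s≤s (ℕ.+-monoʳ-≤ r z≤n))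
  xₛ<N : suc t < 2 ℕ.+ (r ℕ.+ r)
  xₛ<N = ℕ.m<n⇒m<1+n (s≤s (ℕ.≤-trans (ℕ.n≤1+n (suc t)) (ℕ.m≤m+n r r)))
  w₀<N : r ℕ.+ r < 2 ℕ.+ (r ℕ.+ r)
  w₀<N = ℕ.m<n+m (r ℕ.+ r) {2} z<s
  w₁<N : suc (r ℕ.+ r) < 2 ℕ.+ (r ℕ.+ r)
  w₁<N = ℕ.n<1+n (suc (r ℕ.+ r))
  w₀x₀ : ∣ Lᵛ r (decode r (r ℕ.+ r)) (decode r 0) ∣ ≡ 2
  w₀x₀ rewrite decode-w₀ r = refl
  w₀y₀ : ∣ Lᵛ r (decode r (r ℕ.+ r)) (decode r (r ℕ.+ 0)) ∣ ≡ 2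
  w₀y₀ rewrite decode-w₀ r | decode-y r {0} z<s = refl
  w₁xₛ : ∣ Lᵛ r (decode r (suc (r ℕ.+ r))) (decode r (suc t)) ∣ ≡ 2
  w₁xₛ rewrite decode-w₁ r | decode-x (ℕ.n<1+n (suc t)) | ≡ᵇ-refl t = refl
  distinct : ¬ (0 ≡ r ℕ.+ 0 ⊎ 0 ≡ suc t ⊎ r ℕ.+ 0 ≡ suc t)
  distinct (inj₁ ())
  distinct (inj₂ (inj₁ ()))
  distinct (inj₂ (inj₂ r+0≡1+t)) = ℕ.m≢1+m+n (suc t) (sym r+0≡1+t)

L-not-equivalent-L′ : ∀ r → 1 ≤ r → ¬ Equivalent (L r) (L' r)
L-not-equivalent-L′ (suc s) _ L≅L′ =
  distinct (rows-with-∣2∣-collide {r = r} S (r ℕ.+ r) s (r ℕ.+ s) 0 (suc (r ℕ.+ r)) (suc (r ℕ.+ r))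
              w₀<N xₛ<N yₛ<N z<s w₁<N w₁<N w₀x₀ xₛw₁ yₛw₁)
  where
  r : ℕ
  r = suc s
  S : AbsConjugate (2 ℕ.+ (r ℕ.+ r)) (decoded r (Lᵛ r)) (decoded r (L′ᵛ r))
  S = equivalent⇒absConjugate (decoded r (Lᵛ r)) (decoded r (L′ᵛ r)) L≅L′
  xₛ<yₛ : s < r ℕ.+ s
  xₛ<yₛ = s≤s (ℕ.m≤m+n s s)
  yₛ<w₀ : r ℕ.+ s < r ℕ.+ r
  yₛ<w₀ = ℕ.+-monoʳ-< r (ℕ.n<1+n s)
  w₀<N : r ℕ.+ r < 2 ℕ.+ (r ℕ.+ r)
  w₀<N = ℕ.m<n+m (r ℕ.+ r) {2} z<s
  w₁<N : suc (r ℕ.+ r) < 2 ℕ.+ (r ℕ.+ r)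
  w₁<N = ℕ.n<1+n (suc (r ℕ.+ r))
  yₛ<N : r ℕ.+ s < 2 ℕ.+ (r ℕ.+ r)
  yₛ<N = ℕ.<-trans yₛ<w₀ w₀<N
  xₛ<N : s < 2 ℕ.+ (r ℕ.+ r)
  xₛ<N = ℕ.<-trans xₛ<yₛ yₛ<N
  w₀x₀ : ∣ L′ᵛ r (decode r (r ℕ.+ r)) (decode r 0) ∣ ≡ 2
  w₀x₀ rewrite decode-w₀ r = refl
  xₛw₁ : ∣ L′ᵛ r (decode r s) (decode r (suc (r ℕ.+ r))) ∣ ≡ 2
  xₛw₁ rewrite decode-x (ℕ.n<1+n s) | decode-w₁ r | ≡ᵇ-refl s = refl
  yₛw₁ : ∣ L′ᵛ r (decode r (r ℕ.+ s)) (decode r (suc (r ℕ.+ r))) ∣ ≡ 2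
  yₛw₁ rewrite decode-y r (ℕ.n<1+n s) | decode-w₁ r | ≡ᵇ-refl s = refl
  distinct : ¬ (r ℕ.+ r ≡ s ⊎ r ℕ.+ r ≡ r ℕ.+ s ⊎ s ≡ r ℕ.+ s)
  distinct (inj₁ w₀≡xₛ)        = ℕ.<⇒≢ (ℕ.<-trans xₛ<yₛ yₛ<w₀) (sym w₀≡xₛ)
  distinct (inj₂ (inj₁ w₀≡yₛ)) = ℕ.<⇒≢ yₛ<w₀ (sym w₀≡yₛ)
  distinct (inj₂ (inj₂ xₛ≡yₛ)) = ℕ.<⇒≢ xₛ<yₛ xₛ≡yₛ

L⁺-not-self-transpose : ∀ r → 1 ≤ r → ¬ Equivalent (L⁺ r) (L⁺ r ᵀ)
L⁺-not-self-transpose (suc s) _ L⁺≅L⁺ᵀ =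
  case τ-injective 0 (r ℕ.+ 0) z<s y₀<N (trans (τ-at-w₀ 0 z<s x₀w₀) (sym (τ-at-w₀ (r ℕ.+ 0) y₀<N y₀w₀))) of λ ()
  where
  r : ℕ
  r = suc s
  S : AbsConjugate (suc (r ℕ.+ r)) (decoded r (L⁺ᵛ r)) (flip (decoded r (L⁺ᵛ r)))
  S = self-transpose⇒AbsConjugate-flip (decoded r (L⁺ᵛ r)) L⁺≅L⁺ᵀ
  open AbsConjugate S
  w₀<N : r ℕ.+ r < suc (r ℕ.+ r)
  w₀<N = ℕ.n<1+n (r ℕ.+ r)
  y₀<N : r ℕ.+ 0 < suc (r ℕ.+ r)
  y₀<N = s≤s (ℕ.+-monoʳ-≤ r z≤n)
  τ-at-w₀ : ∀ k .p → ∣ L⁺ᵛ r (decode r k) (decode r (r ℕ.+ r)) ∣ ≡ 2 → τ k p ≡ r ℕ.+ r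
  τ-at-w₀ k p kw₀ = ℕ.≤-antisym (ℕ.≤-pred (τ-< k p))
    (decode-attachment⇒≥ r (τ k p) (inj₁ (L⁺ᵛ-∣2∣ r (decode r (τ (r ℕ.+ r) w₀<N)) (decode r (τ k p))
                                             (trans (∣f∘τ∣≡∣g∣ (r ℕ.+ r) k w₀<N p) kw₀))))
  x₀w₀ : ∣ L⁺ᵛ r (decode r 0) (decode r (r ℕ.+ r)) ∣ ≡ 2
  x₀w₀ rewrite decode-w₀ r = refl
  y₀w₀ : ∣ L⁺ᵛ r (decode r (r ℕ.+ 0)) (decode r (r ℕ.+ r)) ∣ ≡ 2
  y₀w₀ rewrite decode-w₀ r | decode-y r {0} z<s = refl

corollary28 :
    (∀ (n : ℕ) → 2 ≤ n → ¬ Equivalent (M n) (M n ᵀ))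
    × (∀ (n : ℕ) → 3 ≤ n → ¬ Equivalent (B n) (B n ᵀ))
    × (∀ (n : ℕ) → 3 ≤ n → ¬ Equivalent (Bt n) (Bt n ᵀ))
    × (∀ (n : ℕ) → 2 ≤ n → ¬ Equivalent (Ct n) (Ct n ᵀ))
    × ¬ Equivalent F4t (F4t ᵀ)
    × ¬ Equivalent G2t (G2t ᵀ)
    × (∀ (r : ℕ) → 2 ≤ r → ¬ Equivalent (L r) (L r ᵀ))
    × (∀ (r : ℕ) → 1 ≤ r → ¬ Equivalent (L⁺ r) (L⁺ r ᵀ))
    × (∀ (r : ℕ) → 1 ≤ r → ¬ Equivalent (L r) (L' r))
corollary28 =
  M-not-self-transpose , B-not-self-transpose , Bt-not-self-transpose , Ct-not-self-transpose ,
  F4-not-self-transpose , G2-not-self-transpose , L-not-self-transpose , L⁺-not-self-transpose ,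
  L-not-equivalent-L′
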